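{- Let $n>4$ be odd and let $p$ be an integer with $n\le p\le 5\lceil n/2\rceil+3$. Then the $\infty$-digraph $C_n\cdot C_p$ admits a quasi-$\left(4,\lceil n/2\rceil+1\right)$-labeling.
   Context: All digraphs are finite. For integers $\alpha>0$, $k>1$, a quasi-$(\alpha,k)$-labeling of a digraph $D=(V,A)$ assigns to each vertex $x$ a string $(l_1(x),\dots,l_k(x))$ with entries in $\{1,\dots,\alpha\}$ such that distinct vertices receive distinct strings and, whenever $xy\in A$, $l_i(x)=l_{i-1}(y)$ for all $i\in\{2,\dots,k\}$. The $\infty$-digraph $C_n\cdot C_p$ is obtained from a directed cycle $C_n$ of length $n$ and a directed cycle $C_p$ of length $p$, otherwise vertex-disjoint, by identifying one vertex of $C_n$ with one vertex of $C_p$. -}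

module Defs where

open import Data.Nat using (ℕ; suc; _+_; _∸_; _<_; _≤_)
open import Data.Fin using (Fin; toℕ; fromℕ<)
open import Data.Product using (_×_)
open import Data.Sum using (_⊎_)
open import Relation.Binary.PropositionalEquality using (_≡_)
open import Function.Definitions using (Injective)

record Digraph : Set₁ where
  field
    order : ℕ
    Arc   : Fin order → Fin order → Set

open Digraph public

-- A string (l_1,...,l_k) with entries in {1,...,α}, encoded as a vector
-- Fin k → Fin α (position i+1 ↦ index i, label a+1 ↦ a : Fin α).
-- Two strings are the same iff they agree pointwise.
SameString : ∀ {α k} → (Fin k → Fin α) → (Fin k → Fin α) → Set
SameString {k = k} s t = (i : Fin k) → s i ≡ t i

-- quasi-(α,k)-labeling of D: distinct vertices receive distinct strings
-- (stated as: equal strings ⇒ equal vertices), and for every arc xy,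
-- l_i(x) = l_{i-1}(y) for all i ∈ {2,…,k}; with 0-based positions this is
-- l_{j+1}(x) = l_j(y) for every j with j+1 < k.
record QuasiLabeling (α k : ℕ) (D : Digraph) : Set where
  field
    label     : Fin (order D) → Fin k → Fin α
    distinct  : Injective _≡_ SameString label
    shift     : ∀ x y → Arc D x y →
                (j : ℕ) (j<k : j < k) (j+1<k : suc j < k) →
                label x (fromℕ< j+1<k) ≡ label y (fromℕ< j<k)

-- The ∞-digraph C_n · C_p on vertices {0,…,n+p-2}:
--   vertex 0 is the identified vertex;
--   C_n : 0 → 1 → … → n-1 → 0
--   C_p : 0 → n → n+1 → … → n+p-2 → 0
InfArc : (n p : ℕ) → ℕ → ℕ → Set
InfArc n p i j =
     (suc i ≡ j × j < n)
  ⊎ (suc i ≡ n × j ≡ 0)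
  ⊎ (i ≡ 0 × j ≡ n)
  ⊎ (n ≤ i × suc i ≡ j)
  ⊎ (i ≡ n + p ∸ 2 × j ≡ 0)

InfinityDigraph : (n p : ℕ) → Digraph
InfinityDigraph n p = record
  { order = n + p ∸ 1
  ; Arc   = λ x y → InfArc n p (toℕ x) (toℕ y) }

-- Write m = ⌈n/2⌉ (so n = 2m − 1) and p = L + 1, letters 0,1,2,3 for Fin 4.
-- Every vertex v gets an infinite word: the letters met along the unique walk
-- that leaves v and, once it reaches the shared vertex 0, keeps going round C_n.
-- Along C_n we read the periodic word (3 0^{m−1} 1^{m−1})^ω; along the private
-- path of C_p we read 0^{m−1} 1 2^{m+1} 0^{m+1} 2^{m−1} x 0^ω with x = 2 if
-- p = 4m + 3 and x = 1 otherwise (cut at length L).  Label v by the first m + 1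
-- letters of its word.  An arc xy shifts the word of x onto that of y, which is
-- the arc condition; distinctness holds because an explicit decoder recovers v
-- from its label: it reads the first letter, the length of the initial run and
-- the one or two letters following that run.
module Submission where

open import Data.Nat
open import Data.Nat.Properties
open import Data.Nat.DivMod using ([m+n]%n≡m%n)
open import Data.Nat.Tactic.RingSolver using (solve)
open import Data.Fin as Fin using (Fin; zero; suc; toℕ; fromℕ<)
open import Data.Fin.Properties using (toℕ-injective; toℕ-fromℕ<; toℕ<n)
open import Data.Bool using (true; false; if_then_else_)
open import Data.Product using (_×_; _,_; proj₁; proj₂)
open import Data.Sum using (inj₁; inj₂)
open import Data.Empty using (⊥-elim)
open import Data.List using (_∷_; [])
open import Relation.Nullary using (Dec; yes; no; does)
open import Relation.Nullary.Decidable using (dec-true; dec-false)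
open import Relation.Binary.Definitions using (DecidableEquality)
open import Relation.Binary.PropositionalEquality
open import Defs

windowQuasiLabeling : ∀ {α} (k : ℕ) (D : Digraph) (word : Fin (order D) → ℕ → Fin α)
  (decode : (ℕ → Fin α) → ℕ) →
  (∀ x y → Arc D x y → ∀ j → suc j < k → word x (suc j) ≡ word y j) →
  (∀ x f → (∀ j → j < k → f j ≡ word x j) → decode f ≡ toℕ x) →
  QuasiLabeling α k D
windowQuasiLabeling {α} k D word decode shifts decodes =
  record { label = label ; distinct = distinct ; shift = shift }
  where
  label : Fin (order D) → Fin k → Fin α
  label x i = word x (toℕ i)

  distinct : ∀ {x y} → SameString (label x) (label y) → x ≡ y
  distinct {x} {y} same =
    toℕ-injective (trans (sym (decodes x (word x) (λ _ _ → refl))) (decodes y (word x) agree))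
    where
    agree : ∀ j → j < k → word x j ≡ word y j
    agree j j<k = subst (λ i → word x i ≡ word y i) (toℕ-fromℕ< j<k) (same (fromℕ< j<k))

  shift : ∀ x y → Arc D x y → (j : ℕ) (j<k : j < k) (j+1<k : suc j < k) →
          label x (fromℕ< j+1<k) ≡ label y (fromℕ< j<k)
  shift x y arc j j<k j+1<k rewrite toℕ-fromℕ< j<k | toℕ-fromℕ< j+1<k = shifts x y arc j j+1<k

module RunScan {A : Set} (_≟_ : DecidableEquality A) where

  runEnd : (ℕ → A) → A → ℕ → ℕ → ℕ
  runEnd f a j zero    = j
  runEnd f a j (suc k) = if does (f j ≟ a) then runEnd f a (suc j) k else j

  runEnd-stop : ∀ f a k j d → d ≤ k → (∀ i → i < d → f (j + i) ≡ a) → f (j + d) ≢ a →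
                runEnd f a j k ≡ j + d
  runEnd-stop f a zero j zero _ _ _ = sym (+-identityʳ j)
  runEnd-stop f a (suc k) j zero _ _ f[j]≢a
    rewrite dec-false (f j ≟ a) (λ e → f[j]≢a (trans (cong f (+-identityʳ j)) e)) = sym (+-identityʳ j)
  runEnd-stop f a (suc k) j (suc d) (s≤s d≤k) run f[j+d]≢a
    rewrite dec-true (f j ≟ a) (trans (cong f (sym (+-identityʳ j))) (run 0 z<s)) =
      trans (runEnd-stop f a k (suc j) d d≤k
               (λ i i<d → trans (cong f (sym (+-suc j i))) (run (suc i) (s≤s i<d)))
               (λ e → f[j+d]≢a (trans (cong f (+-suc j d)) e)))
            (sym (+-suc j d))

  runEnd-all : ∀ f a k j → (∀ i → i < k → f (j + i) ≡ a) → runEnd f a j k ≡ j + k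
  runEnd-all f a zero j _ = sym (+-identityʳ j)
  runEnd-all f a (suc k) j run
    rewrite dec-true (f j ≟ a) (trans (cong f (sym (+-identityʳ j))) (run 0 z<s)) =
      trans (runEnd-all f a k (suc j) (λ i i<k → trans (cong f (sym (+-suc j i))) (run (suc i) (s≤s i<k))))
            (sym (+-suc j k))

open RunScan (Fin._≟_ {4})

is-< : ∀ {x y} → x < y → does (x <? y) ≡ true
is-< {x} {y} = dec-true (x <? y)

not-< : ∀ {x y} → y ≤ x → does (x <? y) ≡ false
not-< {x} {y} y≤x = dec-false (x <? y) (≤⇒≯ y≤x)

pattern c0 = zero
pattern c1 = suc zero
pattern c2 = suc (suc zero)
pattern c3 = suc (suc (suc zero))

module Construction (m n L : ℕ) (3≤m : 3 ≤ m) (1+n≡m+m : suc n ≡ m + m)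
                    (n≤p : n ≤ suc L) (p≤5m+3 : suc L ≤ 5 * m + 3) where

  -- Block boundaries of the path word: its 2-block is [m, T2), then the
  -- 0-block [T2, T3), the 2-block [T3, T4), the letter at T4, and 0s from T5.
  T2 T3 Q4 T4 T5 : ℕ
  T2 = suc (m + m)
  T3 = suc (suc (m + m + m))
  Q4 = m + m + m + m
  T4 = suc Q4
  T5 = suc T4

  m<T2 : m < T2
  m<T2 = s≤s (m≤m+n m m)
  T2<T3 : T2 < T3
  T2<T3 = s≤s (s≤s (m≤m+n (m + m) m))
  T3<T4 : T3 < T4
  T3<T4 = s≤s (subst (_≤ Q4) (+-comm (m + m + m) 2) (+-monoʳ-≤ (m + m + m) (≤-trans (s≤s (s≤s z≤n)) 3≤m)))
  T4≤T5 : T4 ≤ T5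
  T4≤T5 = n≤1+n T4
  m≤T4 : m ≤ T4
  m≤T4 = <⇒≤ (<-trans m<T2 (<-trans T2<T3 T3<T4))

  m+2≤n : suc (suc m) ≤ n
  m+2≤n = ≤-pred (subst (3 + m ≤_) (sym 1+n≡m+m) (+-monoˡ-≤ m 3≤m))
  m<n : m < n
  m<n = ≤-trans (n≤1+n _) m+2≤n
  m<L : m < L
  m<L = ≤-pred (≤-trans m+2≤n n≤p)
  0<n : 0 < n
  0<n = ≤-trans z<s m<n

  -- L is short enough that no window starting at T5 or later fits before L.
  L≤m+T5 : L ≤ m + T5
  L≤m+T5 = ≤-pred (subst (suc L ≤_) 5m+3≡m+T5+1 p≤5m+3)
    where
    5m+3≡m+T5+1 : 5 * m + 3 ≡ suc (m + suc (suc (m + m + m + m)))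
    5m+3≡m+T5+1 = solve (m ∷ [])

  -- The 0-block [T2, 3m + 1] and the 2-block [T3, T4] have at most m + 1 letters.
  3m+1≡m+T2 : suc (m + m + m) ≡ m + suc (m + m)
  3m+1≡m+T2 = solve (m ∷ [])
  T4+1≡m+T3 : suc (suc (m + m + m + m)) ≡ m + suc (suc (m + m + m))
  T4+1≡m+T3 = solve (m ∷ [])

  opaque
    cycleWord : ℕ → Fin 4
    cycleWord zero    = c3
    cycleWord (suc q) = if does (suc q <? m) then c0 else c1

    cycleWord-3 : cycleWord 0 ≡ c3
    cycleWord-3 = refl

    cycleWord-0 : ∀ q → 1 ≤ q → q < m → cycleWord q ≡ c0
    cycleWord-0 (suc q) _ q<m rewrite is-< q<m = refl

    cycleWord-1 : ∀ q → m ≤ q → cycleWord q ≡ c1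
    cycleWord-1 zero    m≤0 = ⊥-elim (<⇒≱ (≤-trans z<s 3≤m) m≤0)
    cycleWord-1 (suc q) m≤q rewrite not-< m≤q = refl

  opaque
    pathWord : ℕ → Fin 4
    pathWord s =
      if does (suc s <? m) then c0 else if does (s <? m) then c1 else
      if does (s <? T2) then c2 else if does (s <? T3) then c0 else
      if does (s <? T4) then c2 else
      if does (s <? T5) then (if does (L ≟ T5) then c2 else c1) else c0

    pathWord-0₁ : ∀ s → suc s < m → pathWord s ≡ c0
    pathWord-0₁ s s+1<m rewrite is-< s+1<m = refl

    pathWord-1₁ : ∀ s → suc s ≡ m → pathWord s ≡ c1
    pathWord-1₁ s refl rewrite not-< {suc s} ≤-refl | is-< {s} ≤-refl = refl

    pathWord-2₁ : ∀ s → m ≤ s → s < T2 → pathWord s ≡ c2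
    pathWord-2₁ s m≤s s<T2 rewrite not-< (m≤n⇒m≤1+n m≤s) | not-< m≤s | is-< s<T2 = refl

    pathWord-0₂ : ∀ s → T2 ≤ s → s < T3 → pathWord s ≡ c0
    pathWord-0₂ s T2≤s s<T3
      rewrite not-< (m≤n⇒m≤1+n (≤-trans (<⇒≤ m<T2) T2≤s)) | not-< (≤-trans (<⇒≤ m<T2) T2≤s)
            | not-< T2≤s | is-< s<T3 = refl

    pathWord-2₂ : ∀ s → T3 ≤ s → s < T4 → pathWord s ≡ c2
    pathWord-2₂ s T3≤s s<T4
      rewrite not-< (m≤n⇒m≤1+n (≤-trans (<⇒≤ (<-trans m<T2 T2<T3)) T3≤s))
            | not-< (≤-trans (<⇒≤ (<-trans m<T2 T2<T3)) T3≤s) | not-< (≤-trans (<⇒≤ T2<T3) T3≤s)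
            | not-< T3≤s | is-< s<T4 = refl

    pathWord-x : pathWord T4 ≡ (if does (L ≟ T5) then c2 else c1)
    pathWord-x rewrite not-< (m≤n⇒m≤1+n m≤T4) | not-< m≤T4 | not-< (<⇒≤ (<-trans T2<T3 T3<T4))
                     | not-< (<⇒≤ T3<T4) | not-< {T4} ≤-refl | is-< {T4} ≤-refl = refl

    pathWord-0₃ : ∀ s → T5 ≤ s → pathWord s ≡ c0
    pathWord-0₃ s T5≤s
      rewrite not-< (m≤n⇒m≤1+n (≤-trans m≤T4 (≤-trans T4≤T5 T5≤s))) | not-< (≤-trans m≤T4 (≤-trans T4≤T5 T5≤s))
            | not-< (≤-trans (<⇒≤ (<-trans T2<T3 T3<T4)) (≤-trans T4≤T5 T5≤s))
            | not-< (≤-trans (<⇒≤ T3<T4) (≤-trans T4≤T5 T5≤s)) | not-< (≤-trans T4≤T5 T5≤s)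
            | not-< T5≤s = refl

  pathWord-2ₓ : L ≡ T5 → pathWord T4 ≡ c2
  pathWord-2ₓ L≡T5 = trans pathWord-x (cong (if_then c2 else c1) (dec-true (L ≟ T5) L≡T5))

  pathWord-1ₓ : L ≢ T5 → pathWord T4 ≡ c1
  pathWord-1ₓ L≢T5 = trans pathWord-x (cong (if_then c2 else c1) (dec-false (L ≟ T5) L≢T5))

  pathWord-2₂ₓ : L ≡ T5 → ∀ s → T3 ≤ s → s ≤ T4 → pathWord s ≡ c2
  pathWord-2₂ₓ L≡T5 s T3≤s s≤T4 with m≤n⇒m<n∨m≡n s≤T4
  ... | inj₁ s<T4 = pathWord-2₂ s T3≤s s<T4
  ... | inj₂ refl = pathWord-2ₓ L≡T5

  -- Leaving vertex 0 by the arc 0 → n: the path word continues the cycle word.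
  cycleWord≡pathWord : ∀ j → j < m → cycleWord (suc j) ≡ pathWord j
  cycleWord≡pathWord j j<m with m≤n⇒m<n∨m≡n j<m
  ... | inj₁ j+1<m = trans (cycleWord-0 (suc j) (s≤s z≤n) j+1<m) (sym (pathWord-0₁ j j+1<m))
  ... | inj₂ j+1≡m = trans (cycleWord-1 (suc j) (≤-reflexive (sym j+1≡m))) (sym (pathWord-1₁ j j+1≡m))

  -- Walk words: from position q of C_n (resp. of the private path) the walk
  -- returns to vertex 0 after n − q (resp. L − q) steps and goes round C_n.
  -- word v is the word of vertex v of C_n · C_p (vertices n + t are the path).
  opaque
    cycleWalk : ℕ → Fin 4
    cycleWalk q = if does (q <? n) then cycleWord q else cycleWord (q ∸ n)
    pathWalk : ℕ → Fin 4
    pathWalk q = if does (q <? L) then pathWord q else cycleWord (q ∸ L)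
    word : ℕ → ℕ → Fin 4
    word v j = if does (v <? n) then cycleWalk (v + j) else pathWalk (v ∸ n + j)

    cycleWalk-before : ∀ q → q < n → cycleWalk q ≡ cycleWord q
    cycleWalk-before q q<n rewrite is-< q<n = refl
    cycleWalk-after : ∀ j → cycleWalk (n + j) ≡ cycleWord j
    cycleWalk-after j rewrite not-< (m≤m+n n j) | m+n∸m≡n n j = refl
    pathWalk-before : ∀ q → q < L → pathWalk q ≡ pathWord q
    pathWalk-before q q<L rewrite is-< q<L = refl
    pathWalk-after : ∀ j → pathWalk (L + j) ≡ cycleWord j
    pathWalk-after j rewrite not-< (m≤m+n L j) | m+n∸m≡n L j = refl
    word-cycle : ∀ v j → v < n → word v j ≡ cycleWalk (v + j)
    word-cycle v j v<n rewrite is-< v<n = refl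
    word-path : ∀ t j → word (n + t) j ≡ pathWalk (t + j)
    word-path t j rewrite not-< (m≤m+n n t) | m+n∸m≡n n t = refl

  word-0 : ∀ j → j < n → word 0 j ≡ cycleWord j
  word-0 j j<n = trans (word-cycle 0 j 0<n) (cycleWalk-before j j<n)

  word-cycle-before : ∀ v j → v + j < n → word v j ≡ cycleWord (v + j)
  word-cycle-before v j v+j<n = trans (word-cycle v j (≤-trans (s≤s (m≤m+n v j)) v+j<n)) (cycleWalk-before (v + j) v+j<n)

  -- Arc condition: along every arc uv the word of u, shifted by one, is the
  -- word of v (on the first m letters, which is all the labeling uses).
  word-shift : ∀ u v → InfArc n (suc L) u v → ∀ j → j < m → word u (suc j) ≡ word v j
  word-shift u .(suc u) (inj₁ (refl , u+1<n)) j _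
    rewrite word-cycle u (suc j) (≤-trans (n≤1+n _) u+1<n) | word-cycle (suc u) j u+1<n = cong cycleWalk (+-suc u j)
  word-shift u .0 (inj₂ (inj₁ (u+1≡n , refl))) j j<m = begin
    word u (suc j)           ≡⟨ word-cycle u (suc j) (≤-reflexive u+1≡n) ⟩
    cycleWalk (u + suc j)    ≡⟨ cong cycleWalk (trans (+-suc u j) (cong (_+ j) u+1≡n)) ⟩
    cycleWalk (n + j)        ≡⟨ cycleWalk-after j ⟩
    cycleWord j              ≡⟨ word-0 j (<-trans j<m m<n) ⟨
    word 0 j                 ∎
    where open ≡-Reasoning
  word-shift .0 .n (inj₂ (inj₂ (inj₁ (refl , refl)))) j j<m = begin
    word 0 (suc j)           ≡⟨ word-0 (suc j) (≤-trans (s≤s j<m) m<n) ⟩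
    cycleWord (suc j)        ≡⟨ cycleWord≡pathWord j j<m ⟩
    pathWord j               ≡⟨ pathWalk-before j (<-trans j<m m<L) ⟨
    pathWalk (0 + j)         ≡⟨ word-path 0 j ⟨
    word (n + 0) j           ≡⟨ cong (λ v → word v j) (+-identityʳ n) ⟩
    word n j                 ∎
    where open ≡-Reasoning
  word-shift u .(suc u) (inj₂ (inj₂ (inj₂ (inj₁ (n≤u , refl))))) j _ =
    subst (λ v → word v (suc j) ≡ word (suc v) j) (m+[n∸m]≡n n≤u) (path-step (u ∸ n))
    where
    open ≡-Reasoning
    path-step : ∀ t → word (n + t) (suc j) ≡ word (suc (n + t)) j
    path-step t = begin
      word (n + t) (suc j)     ≡⟨ word-path t (suc j) ⟩
      pathWalk (t + suc j)     ≡⟨ cong pathWalk (+-suc t j) ⟩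
      pathWalk (suc t + j)     ≡⟨ word-path (suc t) j ⟨
      word (n + suc t) j       ≡⟨ cong (λ v → word v j) (+-suc n t) ⟩
      word (suc (n + t)) j     ∎
  word-shift u .0 (inj₂ (inj₂ (inj₂ (inj₂ (refl , refl))))) j j<m =
    last-step (pred L) (suc-pred L {{>-nonZero (≤-<-trans z≤n m<L)}})
    where
    open ≡-Reasoning
    last-step : ∀ L' → suc L' ≡ L → word (n + suc L ∸ 2) (suc j) ≡ word 0 j
    last-step L' L'+1≡L = begin
      word (n + suc L ∸ 2) (suc j) ≡⟨ cong (λ v → word v (suc j)) last-vertex ⟩
      word (n + L') (suc j)        ≡⟨ word-path L' (suc j) ⟩
      pathWalk (L' + suc j)        ≡⟨ cong pathWalk (trans (+-suc L' j) (cong (_+ j) L'+1≡L)) ⟩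
      pathWalk (L + j)             ≡⟨ pathWalk-after j ⟩
      cycleWord j                  ≡⟨ word-0 j (<-trans j<m m<n) ⟨
      word 0 j                     ∎
      where
      last-vertex : n + suc L ∸ 2 ≡ n + L'
      last-vertex = begin
        n + suc L ∸ 2          ≡⟨ cong (λ x → n + suc x ∸ 2) (sym L'+1≡L) ⟩
        n + suc (suc L') ∸ 2   ≡⟨ cong (_∸ 2) (trans (+-suc n (suc L')) (cong suc (+-suc n L'))) ⟩
        n + L'                 ∎

  -- For a label other than that of vertex 0 (which alone starts
  -- with 3), let a be its first letter and r ∈ [1, m + 1] the length of its
  -- initial run of a's.  If r ≤ m, the letters b, c after the run determine
  -- which run of the words this is, and the vertex is that run's end minus r.
  changeTable : Fin 4 → Fin 4 → Fin 4 → ℕ → ℕ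
  changeTable c0 c1 c2 r = n + (m ∸ suc r)   -- 0^r 1 2 : start of the path
  changeTable c0 c1 _  r = m ∸ r             -- 0^r 1   : zeros of C_n
  changeTable c1 c3 _  r = n ∸ r             -- 1^r 3   : ones of C_n
  changeTable c1 c2 _  r = n + (m ∸ r)       -- 1 2     : path vertex m − 1
  changeTable c2 c0 _  r = n + (T2 ∸ r)      -- first 2-block of the path
  changeTable c0 c2 _  r = n + (T3 ∸ r)      -- 0-block of the path
  changeTable c2 c1 _  r = n + (T4 ∸ r)      -- second 2-block, followed by 1
  changeTable c1 c0 _  r = n + (T5 ∸ r)      -- the letter 1 at T4
  changeTable c0 c3 _  r = n + (L ∸ r)       -- a block running into vertex 0
  changeTable c2 c3 _  r = n + (L ∸ r)
  changeTable _  _  _  _ = 0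

  -- A constant label a^{m+1}: only the 2-block at m and the 0-block at T2 are long enough.
  constantWindow : Fin 4 → ℕ
  constantWindow c2 = n + m
  constantWindow _  = n + T2

  decodeRun : Fin 4 → (ℕ → Fin 4) → ℕ → ℕ
  decodeRun a f r = if does (r ≟ suc m) then constantWindow a else changeTable a (f r) (f (suc r)) r

  decodeFrom : Fin 4 → (ℕ → Fin 4) → ℕ
  decodeFrom c3 f = 0
  decodeFrom a  f = decodeRun a f (runEnd f a 1 m)

  decode : (ℕ → Fin 4) → ℕ
  decode f = decodeFrom (f 0) f

  decodeFrom-run : ∀ a f → a ≢ c3 → decodeFrom a f ≡ decodeRun a f (runEnd f a 1 m)
  decodeFrom-run c0 f _ = refl
  decodeFrom-run c1 f _ = refl
  decodeFrom-run c2 f _ = refl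
  decodeFrom-run c3 f a≢3 = ⊥-elim (a≢3 refl)

  decodeRun-change : ∀ a f r → r ≢ suc m → decodeRun a f r ≡ changeTable a (f r) (f (suc r)) r
  decodeRun-change a f r r≢m+1 =
    cong (λ b → if b then constantWindow a else changeTable a (f r) (f (suc r)) r) (dec-false (r ≟ suc m) r≢m+1)

  decodeRun-constant : ∀ a f → decodeRun a f (suc m) ≡ constantWindow a
  decodeRun-constant a f =
    cong (λ b → if b then constantWindow a else changeTable a (f (suc m)) (f (suc (suc m))) (suc m))
         (dec-true (suc m ≟ suc m) refl)

  decode-change : ∀ f a b r → f 0 ≡ a → a ≢ c3 → 1 ≤ r → r ≤ m → (∀ j → 1 ≤ j → j < r → f j ≡ a) →
                  f r ≡ b → b ≢ a → decode f ≡ changeTable a b (f (suc r)) r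
  decode-change f a b (suc d) f0≡a a≢3 _ r≤m run fr≡b b≢a = begin
    decodeFrom (f 0) f                                ≡⟨ cong (λ x → decodeFrom x f) f0≡a ⟩
    decodeFrom a f                                    ≡⟨ decodeFrom-run a f a≢3 ⟩
    decodeRun a f (runEnd f a 1 m)                    ≡⟨ cong (decodeRun a f) run-ends ⟩
    decodeRun a f (suc d)                             ≡⟨ decodeRun-change a f (suc d) (<⇒≢ (s≤s r≤m)) ⟩
    changeTable a (f (suc d)) (f (suc (suc d))) (suc d) ≡⟨ cong (λ x → changeTable a x (f (suc (suc d))) (suc d)) fr≡b ⟩
    changeTable a b (f (suc (suc d))) (suc d)         ∎
    where
    open ≡-Reasoning
    run-ends : runEnd f a 1 m ≡ suc d
    run-ends = runEnd-stop f a m 1 d (≤-trans (n≤1+n d) r≤m)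
                 (λ i i<d → run (suc i) (s≤s z≤n) (s≤s i<d)) (λ e → b≢a (trans (sym fr≡b) e))

  decode-constant : ∀ f a → f 0 ≡ a → a ≢ c3 → (∀ j → 1 ≤ j → j ≤ m → f j ≡ a) → decode f ≡ constantWindow a
  decode-constant f a f0≡a a≢3 run = begin
    decodeFrom (f 0) f                   ≡⟨ cong (λ x → decodeFrom x f) f0≡a ⟩
    decodeFrom a f                       ≡⟨ decodeFrom-run a f a≢3 ⟩
    decodeRun a f (runEnd f a 1 m)       ≡⟨ cong (decodeRun a f) (runEnd-all f a m 1 (λ i i<m → run (suc i) (s≤s z≤n) i<m)) ⟩
    decodeRun a f (suc m)                ≡⟨ decodeRun-constant a f ⟩
    constantWindow a                     ∎
    where open ≡-Reasoning

  -- A vertex 1 ≤ v < m of C_n: its label is 0^{m−v} 1 1 ….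
  decode-cycle-zeros : ∀ v r → v + suc r ≡ m → 1 ≤ v → ∀ f → (∀ j → j ≤ m → f j ≡ word v j) → decode f ≡ v
  decode-cycle-zeros v r v+r+1≡m 1≤v f agree = begin
    decode f                                  ≡⟨ decode-change f c0 c1 R (letter 0 z<s) (λ ()) (s≤s z≤n) R≤m
                                                    (λ j _ j<R → letter j j<R) one (λ ()) ⟩
    changeTable c0 c1 (f (suc R)) R           ≡⟨ cong (λ x → changeTable c0 c1 x R) one-more ⟩
    m ∸ R                                     ≡⟨ cong (_∸ R) (sym v+r+1≡m) ⟩
    v + R ∸ R                                 ≡⟨ m+n∸n≡m v R ⟩
    v                                         ∎
    where
    open ≡-Reasoning
    R = suc r
    R≤m : R ≤ m
    R≤m = subst (R ≤_) v+r+1≡m (m≤n+m R v)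
    letter : ∀ j → j < R → f j ≡ c0
    letter j j<R = trans (agree j (≤-trans (<⇒≤ j<R) R≤m))
      (trans (word-cycle-before v j (<-trans v+j<m m<n)) (cycleWord-0 (v + j) (≤-trans 1≤v (m≤m+n v j)) v+j<m))
      where
      v+j<m : v + j < m
      v+j<m = subst (v + j <_) v+r+1≡m (+-monoʳ-< v j<R)
    one : f R ≡ c1
    one = trans (agree R R≤m)
      (trans (word-cycle-before v R (subst (_< n) (sym v+r+1≡m) m<n)) (cycleWord-1 (v + R) (≤-reflexive (sym v+r+1≡m))))
    one-more : f (suc R) ≡ c1
    one-more = trans (agree (suc R) (subst (suc R ≤_) v+r+1≡m (+-monoˡ-≤ R 1≤v)))
      (trans (word-cycle-before v (suc R) (subst (_< n) (sym v+R+1≡m+1) m+2≤n))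
             (cycleWord-1 (v + suc R) (≤-trans (n≤1+n m) (≤-reflexive (sym v+R+1≡m+1)))))
      where
      v+R+1≡m+1 : v + suc R ≡ suc m
      v+R+1≡m+1 = trans (+-suc v R) (cong suc v+r+1≡m)

  -- A vertex m ≤ v < n of C_n: its label is 1^{n−v} 3 ….
  decode-cycle-ones : ∀ v r → v + suc r ≡ n → m ≤ v → ∀ f → (∀ j → j ≤ m → f j ≡ word v j) → decode f ≡ v
  decode-cycle-ones v r v+r+1≡n m≤v f agree = begin
    decode f     ≡⟨ decode-change f c1 c3 R (letter 0 z<s) (λ ()) (s≤s z≤n) R≤m (λ j _ j<R → letter j j<R) three (λ ()) ⟩
    n ∸ R        ≡⟨ cong (_∸ R) (sym v+r+1≡n) ⟩
    v + R ∸ R    ≡⟨ m+n∸n≡m v R ⟩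
    v            ∎
    where
    open ≡-Reasoning
    R = suc r
    R≤m : R ≤ m
    R≤m = <⇒≤ (+-cancelˡ-< m R m (≤-trans (s≤s (subst (m + R ≤_) v+r+1≡n (+-monoˡ-≤ R m≤v))) (≤-reflexive 1+n≡m+m)))
    letter : ∀ j → j < R → f j ≡ c1
    letter j j<R = trans (agree j (≤-trans (<⇒≤ j<R) R≤m))
      (trans (word-cycle-before v j (subst (v + j <_) v+r+1≡n (+-monoʳ-< v j<R))) (cycleWord-1 (v + j) (≤-trans m≤v (m≤m+n v j))))
    three : f R ≡ c3
    three = begin
      f R                    ≡⟨ agree R R≤m ⟩
      word v R               ≡⟨ word-cycle v R (≤-trans (s≤s (m≤m+n v r)) (≤-reflexive (trans (sym (+-suc v r)) v+r+1≡n))) ⟩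
      cycleWalk (v + R)      ≡⟨ cong cycleWalk (trans v+r+1≡n (sym (+-identityʳ n))) ⟩
      cycleWalk (n + 0)      ≡⟨ cycleWalk-after 0 ⟩
      cycleWord 0            ≡⟨ cycleWord-3 ⟩
      c3                     ∎

  -- A path vertex n + t with t + 1 < m: its label is 0^{m−1−t} 1 2 ….
  decode-path-zeros : ∀ t r → suc (t + suc r) ≡ m → ∀ f → (∀ j → j ≤ m → f j ≡ pathWalk (t + j)) → decode f ≡ n + t
  decode-path-zeros t r t+r+2≡m f agree = begin
    decode f                         ≡⟨ decode-change f c0 c1 R (letter 0 z<s) (λ ()) (s≤s z≤n) R≤m
                                          (λ j _ j<R → letter j j<R) one (λ ()) ⟩
    changeTable c0 c1 (f (suc R)) R  ≡⟨ cong (λ x → changeTable c0 c1 x R) two ⟩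
    n + (m ∸ suc R)                  ≡⟨ cong (λ x → n + (x ∸ suc R)) (sym t+r+2≡m) ⟩
    n + (suc (t + R) ∸ suc R)        ≡⟨ cong (n +_) (m+n∸n≡m t R) ⟩
    n + t                            ∎
    where
    open ≡-Reasoning
    R = suc r
    t+R<m : t + R < m
    t+R<m = ≤-reflexive t+r+2≡m
    R≤m : R ≤ m
    R≤m = ≤-trans (m≤n+m R t) (<⇒≤ t+R<m)
    letter : ∀ j → j < R → f j ≡ c0
    letter j j<R = trans (agree j (≤-trans (<⇒≤ j<R) R≤m))
      (trans (pathWalk-before (t + j) (<-trans (<-trans (n<1+n _) t+j+1<m) m<L)) (pathWord-0₁ (t + j) t+j+1<m))
      where
      t+j+1<m : suc (t + j) < m
      t+j+1<m = <-≤-trans (s≤s (+-monoʳ-< t j<R)) t+R<m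
    one : f R ≡ c1
    one = trans (agree R R≤m) (trans (pathWalk-before (t + R) (<-trans t+R<m m<L)) (pathWord-1₁ (t + R) t+r+2≡m))
    two : f (suc R) ≡ c2
    two = begin
      f (suc R)              ≡⟨ agree (suc R) (≤-trans (s≤s (m≤n+m R t)) t+R<m) ⟩
      pathWalk (t + suc R)   ≡⟨ cong pathWalk (trans (+-suc t R) t+r+2≡m) ⟩
      pathWalk m             ≡⟨ pathWalk-before m m<L ⟩
      pathWord m             ≡⟨ pathWord-2₁ m ≤-refl m<T2 ⟩
      c2                     ∎

  -- The path vertex n + (m − 1): its label is 1 2 ….
  decode-path-one : ∀ t → suc t ≡ m → ∀ f → (∀ j → j ≤ m → f j ≡ pathWalk (t + j)) → decode f ≡ n + t
  decode-path-one t t+1≡m f agree =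
    trans (decode-change f c1 c2 1 one (λ ()) (s≤s z≤n) 1≤m (λ { j (s≤s _) (s≤s ()) }) two (λ ()))
          (cong (λ x → n + (x ∸ 1)) (sym t+1≡m))
    where
    1≤m : 1 ≤ m
    1≤m = ≤-trans (s≤s z≤n) 3≤m
    one : f 0 ≡ c1
    one = trans (agree 0 z≤n) (trans (cong pathWalk (+-identityʳ t))
            (trans (pathWalk-before t (<-trans (≤-reflexive t+1≡m) m<L)) (pathWord-1₁ t t+1≡m)))
    two : f 1 ≡ c2
    two = trans (agree 1 1≤m) (trans (cong pathWalk (trans (+-comm t 1) t+1≡m))
            (trans (pathWalk-before m m<L) (pathWord-2₁ m ≤-refl m<T2)))

  -- The path vertex n + T4 when it carries the letter 1: its label is 1 0 ….
  decode-path-T4 : L ≢ T5 → T4 < L → ∀ f → (∀ j → j ≤ m → f j ≡ pathWalk (T4 + j)) → decode f ≡ n + T4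
  decode-path-T4 L≢T5 T4<L f agree =
    decode-change f c1 c0 1 first-letter (λ ()) (s≤s z≤n) 1≤m (λ { j (s≤s _) (s≤s ()) }) second-letter (λ ())
    where
    1≤m : 1 ≤ m
    1≤m = ≤-trans (s≤s z≤n) 3≤m
    first-letter : f 0 ≡ c1
    first-letter = trans (agree 0 z≤n) (trans (cong pathWalk (+-identityʳ T4)) (trans (pathWalk-before T4 T4<L) (pathWord-1ₓ L≢T5)))
    second-letter : f 1 ≡ c0
    second-letter = trans (agree 1 1≤m) (trans (cong pathWalk (+-comm T4 1))
              (trans (pathWalk-before T5 (≤∧≢⇒< T4<L (λ e → L≢T5 (sym e)))) (pathWord-0₃ T5 ≤-refl)))

  -- A block [A, B] of the path word with constant letter a ≠ 3 and length at
  -- most m + 1.  A label starting inside the block is a^r followed by the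
  -- letter ending the block (at B + 1, or the 3 of vertex 0 if the block runs
  -- into L), unless the whole window lies in the block; `full-window` says
  -- that constantWindow a then points to the right vertex.
  module ConstantBlock (A B : ℕ) (a : Fin 4) (a≢3 : a ≢ c3)
           (in-block : ∀ s → A ≤ s → s ≤ B → pathWord s ≡ a) (short : B ≤ m + A)
           (full-window : ∀ t → A ≤ t → suc (m + t) ≤ L → suc (m + t) ≤ suc B → constantWindow a ≡ n + t) where

    decode-until : ∀ t E b → A ≤ t → t < E → E ≤ suc B → E ≤ L → pathWalk E ≡ b → b ≢ a →
                   (∀ c r → changeTable a b c r ≡ n + (E ∸ r)) →
                   ∀ f → (∀ j → j ≤ m → f j ≡ pathWalk (t + j)) → decode f ≡ n + t
    decode-until t E b A≤t t<E E≤B+1 E≤L E↦b b≢a table f agree = by-run-length (r ≤? m)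
      where
      open ≡-Reasoning
      r : ℕ
      r = E ∸ t
      t+r≡E : t + r ≡ E
      t+r≡E = m+[n∸m]≡n (<⇒≤ t<E)
      1≤r : 1 ≤ r
      1≤r = +-cancelˡ-< t 0 r (subst₂ _<_ (sym (+-identityʳ t)) (sym t+r≡E) t<E)
      in-run : ∀ {j} → j < r → t + j < E
      in-run j<r = subst (_ <_) t+r≡E (+-monoʳ-< t j<r)
      letter : ∀ j → j ≤ m → t + j < E → f j ≡ a
      letter j j≤m t+j<E = trans (agree j j≤m) (trans (pathWalk-before (t + j) (<-≤-trans t+j<E E≤L))
                             (in-block (t + j) (≤-trans A≤t (m≤m+n t j)) (≤-pred (<-≤-trans t+j<E E≤B+1))))
      first-letter : f 0 ≡ a
      first-letter = letter 0 z≤n (subst (_< E) (sym (+-identityʳ t)) t<E)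

      by-run-length : Dec (r ≤ m) → decode f ≡ n + t
      by-run-length (yes r≤m) = begin
        decode f                          ≡⟨ decode-change f a b r first-letter a≢3 1≤r r≤m
                                               (λ j _ j<r → letter j (≤-trans (<⇒≤ j<r) r≤m) (in-run j<r)) f[r]≡b b≢a ⟩
        changeTable a b (f (suc r)) r     ≡⟨ table (f (suc r)) r ⟩
        n + (E ∸ r)                       ≡⟨ cong (λ x → n + (x ∸ r)) (sym t+r≡E) ⟩
        n + (t + r ∸ r)                   ≡⟨ cong (n +_) (m+n∸n≡m t r) ⟩
        n + t                             ∎
        where
        f[r]≡b : f r ≡ b
        f[r]≡b = trans (agree r r≤m) (trans (cong pathWalk t+r≡E) E↦b)
      by-run-length (no r≰m) = begin
        decode f               ≡⟨ decode-constant f a first-letter a≢3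
                                    (λ j _ j≤m → letter j j≤m (in-run (≤-<-trans j≤m (≰⇒> r≰m)))) ⟩
        constantWindow a       ≡⟨ full-window t A≤t (subst (_≤ L) E≡m+t+1 E≤L) (subst (_≤ suc B) E≡m+t+1 E≤B+1) ⟩
        n + t                  ∎
        where
        r≤m+1 : r ≤ suc m
        r≤m+1 = +-cancelˡ-≤ t r (suc m) (subst (_≤ t + suc m) (sym t+r≡E)
                  (≤-trans E≤B+1 (≤-trans (s≤s (≤-trans short (+-monoʳ-≤ m A≤t)))
                    (≤-reflexive (trans (cong suc (+-comm m t)) (sym (+-suc t m)))))))
        E≡m+t+1 : E ≡ suc (m + t)
        E≡m+t+1 = begin
          E           ≡⟨ t+r≡E ⟨
          t + r       ≡⟨ cong (t +_) (≤-antisym r≤m+1 (≰⇒> r≰m)) ⟩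
          t + suc m   ≡⟨ +-suc t m ⟩
          suc (t + m) ≡⟨ cong suc (+-comm t m) ⟩
          suc (m + t) ∎

    decode-block : (b : Fin 4) →
      (suc B < L → pathWord (suc B) ≡ b × b ≢ a × (∀ c r → changeTable a b c r ≡ n + (suc B ∸ r))) →
      (∀ c r → changeTable a c3 c r ≡ n + (L ∸ r)) →
      ∀ t → A ≤ t → t ≤ B → t < L → ∀ f → (∀ j → j ≤ m → f j ≡ pathWalk (t + j)) → decode f ≡ n + t
    decode-block b next into-0 t A≤t t≤B t<L f agree with suc B <? L
    ... | yes B+1<L = decode-until t (suc B) b A≤t (s≤s t≤B) ≤-refl (<⇒≤ B+1<L)
                        (trans (pathWalk-before (suc B) B+1<L) (proj₁ (next B+1<L)))
                        (proj₁ (proj₂ (next B+1<L))) (proj₂ (proj₂ (next B+1<L))) f agree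
    ... | no B+1≮L  = decode-until t L c3 A≤t t<L (≮⇒≥ B+1≮L) ≤-refl
                        (trans (cong pathWalk (sym (+-identityʳ L))) (trans (pathWalk-after 0) cycleWord-3))
                        (λ 3≡a → a≢3 (sym 3≡a)) into-0 f agree

  module Block2₁ = ConstantBlock m (m + m) c2 (λ ()) (λ s m≤s s≤2m → pathWord-2₁ s m≤s (s≤s s≤2m)) ≤-refl
      (λ t m≤t _ m+t<2m+1 → cong (n +_) (≤-antisym (+-cancelˡ-≤ m m t (+-monoʳ-≤ m m≤t)) (+-cancelˡ-≤ m t m (≤-pred m+t<2m+1))))
  module Block0₂ = ConstantBlock T2 (suc (m + m + m)) c0 (λ ()) (λ s T2≤s s≤B → pathWord-0₂ s T2≤s (s≤s s≤B))
      (≤-reflexive 3m+1≡m+T2)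
      (λ t T2≤t _ m+t<B+1 → cong (n +_) (≤-antisym T2≤t (+-cancelˡ-≤ m t T2 (≤-trans (≤-pred m+t<B+1) (≤-reflexive 3m+1≡m+T2)))))
  module Block2₂ = ConstantBlock T3 Q4 c2 (λ ()) (λ s T3≤s s≤Q4 → pathWord-2₂ s T3≤s (s≤s s≤Q4))
      (≤-trans (n≤1+n _) (≤-trans (n≤1+n _) (≤-reflexive T4+1≡m+T3)))
      (λ t T3≤t _ m+t<Q4+1 → ⊥-elim (<⇒≱ (≤-trans (n≤1+n _) (≤-trans (≤-reflexive T4+1≡m+T3) (+-monoʳ-≤ m T3≤t))) (≤-pred m+t<Q4+1)))
  module Block2₂ₓ (L≡T5 : L ≡ T5) = ConstantBlock T3 T4 c2 (λ ()) (pathWord-2₂ₓ L≡T5)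
      (≤-trans (n≤1+n _) (≤-reflexive T4+1≡m+T3))
      (λ t T3≤t _ m+t<T4+1 → ⊥-elim (<⇒≱ (≤-trans (≤-reflexive T4+1≡m+T3) (+-monoʳ-≤ m T3≤t)) (≤-pred m+t<T4+1)))
  module Block0₃ = ConstantBlock T5 (m + T5) c0 (λ ()) (λ s T5≤s _ → pathWord-0₃ s T5≤s) ≤-refl
      (λ t T5≤t m+t<L _ → ⊥-elim (<⇒≱ (≤-trans (s≤s (+-monoʳ-≤ m T5≤t)) m+t<L) L≤m+T5))

  decode-path : ∀ t → t < L → ∀ f → (∀ j → j ≤ m → f j ≡ pathWalk (t + j)) → decode f ≡ n + t
  decode-path t t<L f agree with suc t <? m
  ... | yes t+1<m = decode-path-zeros t (m ∸ suc (suc t)) (trans (cong suc (+-suc t _)) (m+[n∸m]≡n t+1<m)) f agree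
  ... | no t+1≮m with suc t ≟ m
  ... | yes t+1≡m = decode-path-one t t+1≡m f agree
  ... | no t+1≢m with t <? T2
  ... | yes t<T2 = Block2₁.decode-block c0 (λ _ → pathWord-0₂ T2 ≤-refl T2<T3 , (λ ()) , λ _ _ → refl) (λ _ _ → refl)
                     t (≤-pred (≤∧≢⇒< (≮⇒≥ t+1≮m) (λ m≡t+1 → t+1≢m (sym m≡t+1)))) (≤-pred t<T2) t<L f agree
  ... | no t≮T2 with t <? T3
  ... | yes t<T3 = Block0₂.decode-block c2 (λ _ → pathWord-2₂ T3 ≤-refl T3<T4 , (λ ()) , λ _ _ → refl) (λ _ _ → refl)
                     t (≮⇒≥ t≮T2) (≤-pred t<T3) t<L f agree
  ... | no t≮T3 with L ≟ T5
  ... | yes L≡T5 = Block2₂ₓ.decode-block L≡T5 c1 (λ T5<L → ⊥-elim (<⇒≢ T5<L (sym L≡T5))) (λ _ _ → refl)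
                     t (≮⇒≥ t≮T3) (≤-pred (subst (t <_) L≡T5 t<L)) t<L f agree
  ... | no L≢T5 with t <? T4
  ... | yes t<T4 = Block2₂.decode-block c1 (λ _ → pathWord-1ₓ L≢T5 , (λ ()) , λ _ _ → refl) (λ _ _ → refl)
                     t (≮⇒≥ t≮T3) (≤-pred t<T4) t<L f agree
  ... | no t≮T4 with t <? T5
  ... | yes t<T5 = subst (λ x → decode f ≡ n + x) (sym t≡T4)
                     (decode-path-T4 L≢T5 (subst (_< L) t≡T4 t<L) f (λ j j≤m → trans (agree j j≤m) (cong (λ x → pathWalk (x + j)) t≡T4)))
    where
    t≡T4 : t ≡ T4
    t≡T4 = ≤-antisym (≤-pred t<T5) (≮⇒≥ t≮T4)
  ... | no t≮T5 = Block0₃.decode-block c1 (λ m+T5<L → ⊥-elim (<⇒≱ (≤-trans (n≤1+n _) m+T5<L) L≤m+T5)) (λ _ _ → refl)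
                     t (≮⇒≥ t≮T5) (≤-trans (<⇒≤ t<L) L≤m+T5) t<L f agree

  decode-correct : ∀ v → v < n + L → ∀ f → (∀ j → j ≤ m → f j ≡ word v j) → decode f ≡ v
  decode-correct v v<n+L f agree with v <? n
  decode-correct zero _ f agree | yes _ = cong (λ x → decodeFrom x f) (trans (agree 0 z≤n) (trans (word-0 0 0<n) cycleWord-3))
  decode-correct (suc v) _ f agree | yes v<n with suc v <? m
  ... | yes v+1<m = decode-cycle-zeros (suc v) (m ∸ suc (suc v)) (trans (+-suc (suc v) _) (m+[n∸m]≡n v+1<m)) (s≤s z≤n) f agree
  ... | no v+1≮m  = decode-cycle-ones (suc v) (n ∸ suc (suc v)) (trans (+-suc (suc v) _) (m+[n∸m]≡n v<n)) (≮⇒≥ v+1≮m) f agree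
  decode-correct v v<n+L f agree | no v≮n = trans (decode-path t t<L f agree′) n+t≡v
    where
    t = v ∸ n
    n+t≡v : n + t ≡ v
    n+t≡v = m+[n∸m]≡n (≮⇒≥ v≮n)
    t<L : t < L
    t<L = +-cancelˡ-< n t L (subst (_< n + L) (sym n+t≡v) v<n+L)
    agree′ : ∀ j → j ≤ m → f j ≡ pathWalk (t + j)
    agree′ j j≤m = trans (agree j j≤m) (trans (cong (λ x → word x j) (sym n+t≡v)) (word-path t j))

  quasiLabeling : QuasiLabeling 4 (suc m) (InfinityDigraph n (suc L))
  quasiLabeling = windowQuasiLabeling (suc m) (InfinityDigraph n (suc L)) (λ x → word (toℕ x)) decode
    (λ x y arc j j+1<m+1 → word-shift (toℕ x) (toℕ y) arc j (≤-pred j+1<m+1))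
    (λ x f agree → decode-correct (toℕ x) (vertex-bound x) f (λ j j≤m → agree j (s≤s j≤m)))
    where
    vertex-bound : (x : Fin (n + suc L ∸ 1)) → toℕ x < n + L
    vertex-bound x = subst (toℕ x <_) (cong (_∸ 1) (+-suc n L)) (toℕ<n x)

odd⇒1+n≡2⌈n/2⌉ : ∀ n → n % 2 ≡ 1 → suc n ≡ ⌈ n /2⌉ + ⌈ n /2⌉
odd⇒1+n≡2⌈n/2⌉ (suc zero) _ = refl
odd⇒1+n≡2⌈n/2⌉ (suc (suc n)) n+2-odd =
  cong suc (trans (cong suc (odd⇒1+n≡2⌈n/2⌉ n n-odd)) (sym (+-suc ⌈ n /2⌉ ⌈ n /2⌉)))
  where
  n-odd : n % 2 ≡ 1
  n-odd = trans (sym ([m+n]%n≡m%n n 2)) (trans (cong (_% 2) (+-comm n 2)) n+2-odd)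

theorem6 : (n p : ℕ) → n % 2 ≡ 1 → 4 < n → n ≤ p → p ≤ 5 * ⌈ n /2⌉ + 3 →
    QuasiLabeling 4 (⌈ n /2⌉ + 1) (InfinityDigraph n p)
theorem6 n zero _ 4<n n≤0 _ = ⊥-elim (<⇒≱ (≤-trans z<s 4<n) n≤0)
theorem6 n (suc L) n-odd 4<n n≤p p≤5m+3 =
  subst (λ k → QuasiLabeling 4 k (InfinityDigraph n (suc L))) (+-comm 1 ⌈ n /2⌉)
    (Construction.quasiLabeling ⌈ n /2⌉ n L (⌈n/2⌉-mono 4<n) (odd⇒1+n≡2⌈n/2⌉ n n-odd) n≤p p≤5m+3)
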